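{- Let $p$ be a prime and $F\colon\mathbb F_p^n\to\mathbb F_p^m$ a function with $m\le n/2$. Then there exists an $\mathbb F_p$-linear function $L\colon\mathbb F_p^n\to\mathbb F_p^m$ such that $F+L$ is surjective. -}

module Defs where

open import Data.Nat using (ℕ; NonZero; _+_; _*_)
open import Data.Nat.DivMod using (_mod_)
open import Data.Fin using (Fin; toℕ)
open import Relation.Binary.PropositionalEquality using (_≡_; _≗_)

-- The prime field 𝔽_p, modelled as ℤ/pℤ = Fin p with arithmetic mod p.
-- (It is a field exactly when p is prime, which the theorem assumes.)
𝔽 : ℕ → Set
𝔽 p = Fin p

module _ {p : ℕ} {{_ : NonZero p}} where

  infixl 6 _+ₚ_
  infixl 7 _*ₚ_

  _+ₚ_ : 𝔽 p → 𝔽 p → 𝔽 p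
  a +ₚ b = (toℕ a + toℕ b) mod p

  _*ₚ_ : 𝔽 p → 𝔽 p → 𝔽 p
  a *ₚ b = (toℕ a * toℕ b) mod p

𝔽^ : ℕ → ℕ → Set
𝔽^ p n = Fin n → 𝔽 p

module _ {p : ℕ} {{_ : NonZero p}} where

  _⊕_ : ∀ {n} → 𝔽^ p n → 𝔽^ p n → 𝔽^ p n
  (x ⊕ y) i = x i +ₚ y i

  _⊙_ : ∀ {n} → 𝔽 p → 𝔽^ p n → 𝔽^ p n
  (c ⊙ x) i = c *ₚ x i

  _⊞_ : ∀ {n m} → (𝔽^ p n → 𝔽^ p m) → (𝔽^ p n → 𝔽^ p m) → (𝔽^ p n → 𝔽^ p m)
  (F ⊞ G) x = F x ⊕ G x

  record IsLinear {n m : ℕ} (L : 𝔽^ p n → 𝔽^ p m) : Set where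
    field
      additive    : ∀ x y → L (x ⊕ y) ≗ L x ⊕ L y
      homogeneous : ∀ (c : 𝔽 p) x → L (c ⊙ x) ≗ c ⊙ L x

-- Average, over all linear maps A : 𝔽ₚⁿ → 𝔽ₚᵐ, the number of collisions of F + A, i.e. of pairs (x, x′)
-- with (F + A) x = (F + A) x′. For x ≠ x′ every row of A then satisfies a nontrivial affine equation, so
-- this happens for at most a fraction p⁻ᵐ of all A; with q = pᵐ and Q = pⁿ the average is at most
-- Q + Q²/q. If no F + A were surjective, each would spread its Q arguments over at most q − 1 values
-- and so, by Cauchy–Schwarz, have at least Q²/(q − 1) collisions. Since q² ≤ Q these bounds contradict
-- each other.

module Submission where

open import Data.Empty using (⊥; ⊥-elim)
open import Data.Fin using (Fin; toℕ; zero; suc)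
import Data.Fin.Properties as Fin
open import Data.List using (List; []; _∷_; _++_; map; concatMap; length; tabulate; allFin)
open import Data.List.Properties using (length-tabulate)
open import Data.List.Relation.Unary.All as All using (All; []; _∷_; all?)
open import Data.List.Relation.Unary.All.Properties using (¬All⇒Any¬; ¬Any⇒All¬)
open import Data.List.Relation.Unary.Any as Any using (Any; here; there; any?)
open import Data.Nat using (ℕ; zero; suc; _+_; _*_; _∸_; _^_; _≤_; _<_; z≤n; s≤s; NonZero; >-nonZero; >-nonZero⁻¹)
open import Data.Nat.Properties
open import Data.Nat.DivMod using (_%_; _/_; _mod_; m≡m%n+[m/n]*n; m%n%n≡m%n; %-distribˡ-+; %-distribˡ-*)
open import Data.Nat.Divisibility using (_∣_; ∣m+n∣m⇒∣n; n∣m*n; >⇒∤)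
open import Data.Nat.Primality using (Prime; euclidsLemma)
open import Data.Nat.Tactic.RingSolver using (solve-∀)
open import Data.Product using (Σ-syntax; _×_; _,_)
open import Data.Sum using (_⊎_; inj₁; inj₂)
import Data.Sum as Sum
open import Data.Vec.Functional using () renaming (_∷_ to _∷ᵛ_)
open import Function using (_∘_; id)
open import Function.Definitions using (Surjective)
open import Relation.Binary.PropositionalEquality
open import Relation.Nullary using (¬_; yes; no; contradiction)

open import Defs

-- Finite sums over lists

∑ : {A : Set} → List A → (A → ℕ) → ℕ
∑ []       f = 0
∑ (x ∷ xs) f = f x + ∑ xs f

syntax ∑ xs (λ x → e) = ∑[ x ∈ xs ] e

module _ {A : Set} where

  ∑-cong : ∀ (xs : List A) {f g : A → ℕ} → (∀ x → f x ≡ g x) → ∑ xs f ≡ ∑ xs g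
  ∑-cong []       f≗g = refl
  ∑-cong (x ∷ xs) f≗g = cong₂ _+_ (f≗g x) (∑-cong xs f≗g)

  ∑-mono-≤-on : ∀ {xs : List A} {f g : A → ℕ} → All (λ x → f x ≤ g x) xs → ∑ xs f ≤ ∑ xs g
  ∑-mono-≤-on []            = z≤n
  ∑-mono-≤-on (f≤g ∷ fs≤gs) = +-mono-≤ f≤g (∑-mono-≤-on fs≤gs)

  ∑-mono-≤ : ∀ (xs : List A) {f g : A → ℕ} → (∀ x → f x ≤ g x) → ∑ xs f ≤ ∑ xs g
  ∑-mono-≤ xs f≤g = ∑-mono-≤-on (All.universal f≤g xs)

  ∑-distrib-+ : ∀ (xs : List A) (f g : A → ℕ) → ∑[ x ∈ xs ] (f x + g x) ≡ ∑ xs f + ∑ xs g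
  ∑-distrib-+ []       f g = refl
  ∑-distrib-+ (x ∷ xs) f g = trans (cong (f x + g x +_) (∑-distrib-+ xs f g))
                                   (shuffle (f x) (g x) (∑ xs f) (∑ xs g))
    where
    shuffle : ∀ a b c d → a + b + (c + d) ≡ a + c + (b + d)
    shuffle = solve-∀

  *-distribˡ-∑ : ∀ (xs : List A) c (f : A → ℕ) → c * ∑ xs f ≡ ∑[ x ∈ xs ] (c * f x)
  *-distribˡ-∑ []       c f = *-zeroʳ c
  *-distribˡ-∑ (x ∷ xs) c f = trans (*-distribˡ-+ c (f x) (∑ xs f)) (cong (c * f x +_) (*-distribˡ-∑ xs c f))

  *-distribʳ-∑ : ∀ (xs : List A) c (f : A → ℕ) → ∑ xs f * c ≡ ∑[ x ∈ xs ] (f x * c)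
  *-distribʳ-∑ xs c f = trans (*-comm (∑ xs f) c)
                         (trans (*-distribˡ-∑ xs c f) (∑-cong xs (λ x → *-comm c (f x))))

  ∑-const : ∀ (xs : List A) c → ∑[ x ∈ xs ] c ≡ length xs * c
  ∑-const []       c = refl
  ∑-const (x ∷ xs) c = cong (c +_) (∑-const xs c)

  ∑-++ : ∀ (xs ys : List A) (f : A → ℕ) → ∑ (xs ++ ys) f ≡ ∑ xs f + ∑ ys f
  ∑-++ []       ys f = refl
  ∑-++ (x ∷ xs) ys f = trans (cong (f x +_) (∑-++ xs ys f)) (sym (+-assoc (f x) (∑ xs f) (∑ ys f)))

  ∑-1 : ∀ (xs : List A) → ∑[ x ∈ xs ] 1 ≡ length xs
  ∑-1 xs = trans (∑-const xs 1) (*-identityʳ (length xs))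

  ∑-zero : ∀ (xs : List A) → ∑[ x ∈ xs ] 0 ≡ 0
  ∑-zero xs = trans (∑-const xs 0) (*-zeroʳ (length xs))

  ∑-pos⇒Any : ∀ (xs : List A) (f : A → ℕ) → 0 < ∑ xs f → Any (λ x → 0 < f x) xs
  ∑-pos⇒Any (x ∷ xs) f 0<∑ with f x in fx≡
  ... | zero  = there (∑-pos⇒Any xs f 0<∑)
  ... | suc _ = here (subst (0 <_) (sym fx≡) (s≤s z≤n))

module _ {A B : Set} where

  ∑-map : ∀ (g : A → B) (xs : List A) (f : B → ℕ) → ∑ (map g xs) f ≡ ∑[ x ∈ xs ] f (g x)
  ∑-map g []       f = refl
  ∑-map g (x ∷ xs) f = cong (f (g x) +_) (∑-map g xs f)

  ∑-concatMap : ∀ (g : A → List B) (xs : List A) (f : B → ℕ) →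
    ∑ (concatMap g xs) f ≡ ∑[ x ∈ xs ] ∑ (g x) f
  ∑-concatMap g []       f = refl
  ∑-concatMap g (x ∷ xs) f = trans (∑-++ (g x) (concatMap g xs) f) (cong (∑ (g x) f +_) (∑-concatMap g xs f))

  ∑-comm : ∀ (xs : List A) (ys : List B) (f : A → B → ℕ) →
    ∑[ x ∈ xs ] ∑[ y ∈ ys ] f x y ≡ ∑[ y ∈ ys ] ∑[ x ∈ xs ] f x y
  ∑-comm []       ys f = sym (∑-zero ys)
  ∑-comm (x ∷ xs) ys f = trans (cong (∑ ys (f x) +_) (∑-comm xs ys f))
                               (sym (∑-distrib-+ ys (f x) (λ y → ∑[ x ∈ xs ] f x y)))

  ∑-*-∑ : ∀ (xs : List A) (ys : List B) (f : A → ℕ) (g : B → ℕ) →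
    ∑ xs f * ∑ ys g ≡ ∑[ x ∈ xs ] ∑[ y ∈ ys ] (f x * g y)
  ∑-*-∑ xs ys f g = trans (*-distribʳ-∑ xs (∑ ys g) f) (∑-cong xs (λ x → *-distribˡ-∑ ys (f x) g))

∑-tabulate : ∀ {A : Set} {n} (g : Fin n → A) (f : A → ℕ) → ∑ (tabulate g) f ≡ ∑[ i ∈ allFin n ] f (g i)
∑-tabulate {n = zero}  g f = refl
∑-tabulate {n = suc n} g f = cong (f (g zero) +_) (trans (∑-tabulate (g ∘ suc) f) (sym (∑-tabulate suc (f ∘ g))))

length-allFin : ∀ n → length (allFin n) ≡ n
length-allFin n = length-tabulate {n = n} id

∑-allFin-suc : ∀ {n} (f : Fin (suc n) → ℕ) → ∑ (allFin (suc n)) f ≡ f zero + ∑[ i ∈ allFin n ] f (suc i)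
∑-allFin-suc f = cong (f zero +_) (∑-tabulate suc f)

-- Kronecker deltas and products over Fin

δ : ∀ {n} → Fin n → Fin n → ℕ
δ zero    zero    = 1
δ zero    (suc _) = 0
δ (suc _) zero    = 0
δ (suc a) (suc b) = δ a b

δ≤1 : ∀ {n} (a b : Fin n) → δ a b ≤ 1
δ≤1 zero    zero    = s≤s z≤n
δ≤1 zero    (suc _) = z≤n
δ≤1 (suc _) zero    = z≤n
δ≤1 (suc a) (suc b) = δ≤1 a b

δ-refl : ∀ {n} (a : Fin n) → δ a a ≡ 1
δ-refl zero    = refl
δ-refl (suc a) = δ-refl a

δ-pos⇒≡ : ∀ {n} {a b : Fin n} → 0 < δ a b → a ≡ b
δ-pos⇒≡ {a = zero}  {zero}  _   = refl
δ-pos⇒≡ {a = suc a} {suc b} 0<δ = cong suc (δ-pos⇒≡ 0<δ)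

δ-zero⇒≢ : ∀ {n} {a b : Fin n} → δ a b ≡ 0 → a ≢ b
δ-zero⇒≢ {a = a} δ≡0 refl with trans (sym δ≡0) (δ-refl a)
... | ()

∑-δ : ∀ {n} (a : Fin n) → ∑[ b ∈ allFin n ] δ a b ≡ 1
∑-δ {suc n} a = trans (∑-allFin-suc (δ a)) (split a)
  where
  split : ∀ a → δ a zero + ∑[ i ∈ allFin n ] δ a (suc i) ≡ 1
  split zero    = cong suc (∑-zero (allFin n))
  split (suc a) = ∑-δ a

∑-δ*δ : ∀ {n} (a b : Fin n) → ∑[ c ∈ allFin n ] (δ a c * δ b c) ≡ δ a b
∑-δ*δ {suc n} a b = trans (∑-allFin-suc (λ c → δ a c * δ b c)) (split a b)
  where
  split : ∀ a b → δ a zero * δ b zero + ∑[ i ∈ allFin n ] (δ a (suc i) * δ b (suc i)) ≡ δ a b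
  split zero    zero    = cong suc (∑-zero (allFin n))
  split zero    (suc b) = ∑-zero (allFin n)
  split (suc a) zero    = trans (∑-cong (allFin n) (λ i → *-zeroʳ (δ a i))) (∑-zero (allFin n))
  split (suc a) (suc b) = ∑-δ*δ a b

∑-allFin-≤1 : ∀ {n} (f : Fin n → ℕ) → (∀ a → f a ≤ 1) → (∀ {a b} → f a ≡ 1 → f b ≡ 1 → a ≡ b) →
  ∑ (allFin n) f ≤ 1
∑-allFin-≤1 {zero}  f f≤1 unique = z≤n
∑-allFin-≤1 {suc n} f f≤1 unique rewrite ∑-allFin-suc f with n≤1⇒n≡0∨n≡1 (f≤1 zero)
... | inj₁ f0≡0 rewrite f0≡0 =
  ∑-allFin-≤1 (f ∘ suc) (f≤1 ∘ suc) (λ e e′ → Fin.suc-injective (unique e e′))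
... | inj₂ f0≡1 rewrite f0≡1 = s≤s (≤-reflexive (trans (∑-cong (allFin n) vanishes) (∑-zero (allFin n))))
  where
  vanishes : ∀ i → f (suc i) ≡ 0
  vanishes i with n≤1⇒n≡0∨n≡1 (f≤1 (suc i))
  ... | inj₁ fi≡0 = fi≡0
  ... | inj₂ fi≡1 with unique f0≡1 fi≡1
  ... | ()

∏ : ∀ k → (Fin k → ℕ) → ℕ
∏ zero    f = 1
∏ (suc k) f = f zero * ∏ k (f ∘ suc)

syntax ∏ k (λ i → e) = ∏[ i < k ] e

∏-cong : ∀ k {f g : Fin k → ℕ} → (∀ i → f i ≡ g i) → ∏ k f ≡ ∏ k g
∏-cong zero    f≗g = refl
∏-cong (suc k) f≗g = cong₂ _*_ (f≗g zero) (∏-cong k (f≗g ∘ suc))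

∏-const : ∀ k c → ∏[ i < k ] c ≡ c ^ k
∏-const zero    c = refl
∏-const (suc k) c = cong (c *_) (∏-const k c)

∏-1 : ∀ k → ∏[ i < k ] 1 ≡ 1
∏-1 k = trans (∏-const k 1) (^-zeroˡ k)

∏-mono-≤ : ∀ k {f g : Fin k → ℕ} → (∀ i → f i ≤ g i) → ∏ k f ≤ ∏ k g
∏-mono-≤ zero    f≤g = ≤-refl
∏-mono-≤ (suc k) f≤g = *-mono-≤ (f≤g zero) (∏-mono-≤ k (f≤g ∘ suc))

∏-distrib-* : ∀ k (f g : Fin k → ℕ) → ∏[ i < k ] (f i * g i) ≡ ∏ k f * ∏ k g
∏-distrib-* zero    f g = refl
∏-distrib-* (suc k) f g = trans (cong (f zero * g zero *_) (∏-distrib-* k (f ∘ suc) (g ∘ suc)))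
                                (shuffle (f zero) (g zero) (∏ k (f ∘ suc)) (∏ k (g ∘ suc)))
  where
  shuffle : ∀ a b c d → a * b * (c * d) ≡ a * c * (b * d)
  shuffle = solve-∀

∏-pos⇒pos : ∀ k (f : Fin k → ℕ) → 0 < ∏ k f → ∀ i → 0 < f i
∏-pos⇒pos (suc k) f 0<∏ zero    = >-nonZero⁻¹ _ {{m*n≢0⇒m≢0 (f zero) {{>-nonZero 0<∏}}}}
∏-pos⇒pos (suc k) f 0<∏ (suc i) =
  ∏-pos⇒pos k (f ∘ suc) (>-nonZero⁻¹ _ {{m*n≢0⇒n≢0 (f zero) {{>-nonZero 0<∏}}}}) i

∏-zero⇒zero : ∀ k (f : Fin k → ℕ) → ∏ k f ≡ 0 → Σ[ i ∈ Fin k ] f i ≡ 0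
∏-zero⇒zero (suc k) f ∏≡0 with m*n≡0⇒m≡0∨n≡0 (f zero) ∏≡0
... | inj₁ f0≡0 = zero , f0≡0
... | inj₂ ∏≡0′ with ∏-zero⇒zero k (f ∘ suc) ∏≡0′
... | i , fi≡0 = suc i , fi≡0

-- Enumerating functions between finite sets

functions : ∀ {A : Set} k → List A → List (Fin k → A)
functions zero    as = (λ ()) ∷ []
functions (suc k) as = concatMap (λ a → map (a ∷ᵛ_) (functions k as)) as

∑-functions-suc : ∀ {A : Set} k (as : List A) (f : (Fin (suc k) → A) → ℕ) →
  ∑ (functions (suc k) as) f ≡ ∑[ a ∈ as ] ∑[ r ∈ functions k as ] f (a ∷ᵛ r)
∑-functions-suc k as f =
  trans (∑-concatMap _ as f) (∑-cong as (λ a → ∑-map (a ∷ᵛ_) (functions k as) f))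

∑-functions-∏ : ∀ {A : Set} k (as : List A) (g : Fin k → A → ℕ) →
  ∑[ r ∈ functions k as ] ∏[ i < k ] g i (r i) ≡ ∏[ i < k ] ∑ as (g i)
∑-functions-∏ zero    as g = refl
∑-functions-∏ (suc k) as g = begin
    ∑[ r ∈ functions (suc k) as ] ∏[ i < suc k ] g i (r i)
  ≡⟨ ∑-functions-suc k as _ ⟩
    ∑[ a ∈ as ] ∑[ r ∈ functions k as ] (g zero a * ∏[ i < k ] g (suc i) (r i))
  ≡⟨ ∑-cong as (λ a → sym (*-distribˡ-∑ (functions k as) (g zero a) _)) ⟩
    ∑[ a ∈ as ] (g zero a * ∑[ r ∈ functions k as ] ∏[ i < k ] g (suc i) (r i))
  ≡⟨ ∑-cong as (λ a → cong (g zero a *_) (∑-functions-∏ k as (g ∘ suc))) ⟩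
    ∑[ a ∈ as ] (g zero a * ∏[ i < k ] ∑ as (g (suc i)))
  ≡⟨ sym (*-distribʳ-∑ as _ (g zero)) ⟩
    ∑ as (g zero) * ∏[ i < k ] ∑ as (g (suc i))
  ∎
  where open ≡-Reasoning

length-functions : ∀ {A : Set} k (as : List A) → length (functions k as) ≡ length as ^ k
length-functions k as = begin
  length (functions k as)                      ≡⟨ ∑-1 (functions k as) ⟨
  ∑[ r ∈ functions k as ] 1                    ≡⟨ ∑-cong (functions k as) (λ _ → ∏-1 k) ⟨
  ∑[ r ∈ functions k as ] ∏[ i < k ] 1         ≡⟨ ∑-functions-∏ k as (λ _ _ → 1) ⟩
  ∏[ i < k ] ∑[ a ∈ as ] 1                     ≡⟨ ∏-cong k (λ _ → ∑-1 as) ⟩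
  ∏[ i < k ] length as                         ≡⟨ ∏-const k (length as) ⟩
  length as ^ k                                ∎
  where open ≡-Reasoning

-- Inequalities and identities in ℕ

n≤1⇒n*n≡n : ∀ {n} → n ≤ 1 → n * n ≡ n
n≤1⇒n*n≡n z≤n       = refl
n≤1⇒n*n≡n (s≤s z≤n) = refl

square-mono⁻¹ : ∀ {x y} → x * x ≤ y * y → x ≤ y
square-mono⁻¹ {x} {y} x²≤y² with x ≤? y
... | yes x≤y = x≤y
... | no  x≰y = ⊥-elim (<⇒≱ (*-mono-< (≰⇒> x≰y) (≰⇒> x≰y)) x²≤y²)

am-gm-ordered : ∀ {x y} → x ≤ y → 4 * (x * y) ≤ (x + y) * (x + y)
am-gm-ordered {x} {y} x≤y = subst (λ y → 4 * (x * y) ≤ (x + y) * (x + y)) (m+[n∸m]≡n x≤y)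
  (subst (4 * (x * (x + d)) ≤_) (square-gap x d) (m≤m+n _ (d * d)))
  where
  d = y ∸ x
  square-gap : ∀ a d → 4 * (a * (a + d)) + d * d ≡ (a + (a + d)) * (a + (a + d))
  square-gap = solve-∀

am-gm : ∀ x y → 4 * (x * y) ≤ (x + y) * (x + y)
am-gm x y with ≤-total x y
... | inj₁ x≤y = am-gm-ordered x≤y
... | inj₂ y≤x = subst₂ _≤_ (cong (4 *_) (*-comm y x)) (cong₂ _*_ (+-comm y x) (+-comm y x)) (am-gm-ordered y≤x)

cross-term-bound : ∀ a b A B C → C * C ≤ A * B → 2 * (a * b) * C ≤ a * a * B + b * b * A
cross-term-bound a b A B C C²≤AB = square-mono⁻¹ (begin
    2 * (a * b) * C * (2 * (a * b) * C)   ≡⟨ regroup₁ a b C ⟩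
    4 * (a * b * (a * b)) * (C * C)       ≤⟨ *-monoʳ-≤ (4 * (a * b * (a * b))) C²≤AB ⟩
    4 * (a * b * (a * b)) * (A * B)       ≡⟨ regroup₂ a b A B ⟩
    4 * (a * a * B * (b * b * A))         ≤⟨ am-gm (a * a * B) (b * b * A) ⟩
    (a * a * B + b * b * A) * (a * a * B + b * b * A) ∎)
  where
  open ≤-Reasoning
  regroup₁ : ∀ a b C → 2 * (a * b) * C * (2 * (a * b) * C) ≡ 4 * (a * b * (a * b)) * (C * C)
  regroup₁ = solve-∀
  regroup₂ : ∀ a b A B → 4 * (a * b * (a * b)) * (A * B) ≡ 4 * (a * a * B * (b * b * A))
  regroup₂ = solve-∀

cauchy-schwarz : ∀ {A : Set} (xs : List A) (u v : A → ℕ) →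
  ∑[ x ∈ xs ] (u x * v x) * ∑[ x ∈ xs ] (u x * v x) ≤ ∑[ x ∈ xs ] (u x * u x) * ∑[ x ∈ xs ] (v x * v x)
cauchy-schwarz []       u v = z≤n
cauchy-schwarz (x ∷ xs) u v = begin
    (a * b + C) * (a * b + C)                       ≡⟨ expand a b C ⟩
    a * b * (a * b) + 2 * (a * b) * C + C * C       ≤⟨ +-mono-≤ (+-monoʳ-≤ (a * b * (a * b))
                                                         (cross-term-bound a b A B C ih)) ih ⟩
    a * b * (a * b) + (a * a * B + b * b * A) + A * B ≡⟨ factor a b A B ⟩
    (a * a + A) * (b * b + B)                       ∎
  where
  open ≤-Reasoning
  a = u x
  b = v x
  A = ∑[ x ∈ xs ] (u x * u x)
  B = ∑[ x ∈ xs ] (v x * v x)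
  C = ∑[ x ∈ xs ] (u x * v x)
  ih = cauchy-schwarz xs u v
  expand : ∀ a b C → (a * b + C) * (a * b + C) ≡ a * b * (a * b) + 2 * (a * b) * C + C * C
  expand = solve-∀
  factor : ∀ a b A B → a * b * (a * b) + (a * a * B + b * b * A) + A * B ≡ (a * a + A) * (b * b + B)
  factor = solve-∀

cross-difference : ∀ {a b c d k l} → b ≤ a → d ≤ c →
  a * c + b * d + k ≡ a * d + b * c + l → (a ∸ b) * (c ∸ d) + k ≡ l
cross-difference {a} {b} {c} {d} {k} {l} b≤a d≤c eq =
  +-cancelˡ-≡ ((b + e) * d + b * (d + f)) _ _ (trans (expand b e d f k) eq′)
  where
  e = a ∸ b
  f = c ∸ d
  eq′ : (b + e) * (d + f) + b * d + k ≡ (b + e) * d + b * (d + f) + l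
  eq′ = subst₂ (λ a c → a * c + b * d + k ≡ a * d + b * c + l)
               (sym (m+[n∸m]≡n b≤a)) (sym (m+[n∸m]≡n d≤c)) eq
  expand : ∀ b e d f k → (b + e) * d + b * (d + f) + (e * f + k) ≡ (b + e) * (d + f) + b * d + k
  expand = solve-∀

<∧∣⇒≡0 : ∀ {d e} → e < d → d ∣ e → e ≡ 0
<∧∣⇒≡0 {e = zero}  _   _   = refl
<∧∣⇒≡0 {e = suc e} e<d d∣e = contradiction d∣e (>⇒∤ e<d)

-- Read q and Q as the numbers of values and arguments, M as the number of perturbations of F and T as
-- their total number of collisions.
collision-bounds-incompatible : ∀ q Q M T → 0 < q → 0 < Q → 0 < M → q * q ≤ Q →
  q * T ≤ M * (Q * (q + Q)) → M * (Q * Q) ≤ (q ∸ 1) * T → ⊥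
collision-bounds-incompatible (suc r) Q M T _ 0<Q 0<M q²≤Q upper lower = <⇒≱ Q<q² q²≤Q
  where
  instance
    MQ≢0 : NonZero (M * Q)
    MQ≢0 = >-nonZero (*-mono-< 0<M 0<Q)
  scaled : M * Q * (Q + r * Q) ≤ M * Q * (r * suc r + r * Q)
  scaled = begin
    M * Q * (Q + r * Q)           ≡⟨ regroup₁ M Q r ⟩
    suc r * (M * (Q * Q))         ≤⟨ *-monoʳ-≤ (suc r) lower ⟩
    suc r * (r * T)               ≡⟨ regroup₂ r T ⟩
    r * (suc r * T)               ≤⟨ *-monoʳ-≤ r upper ⟩
    r * (M * (Q * (suc r + Q)))   ≡⟨ regroup₃ r M Q ⟩
    M * Q * (r * suc r + r * Q)   ∎
    where
    open ≤-Reasoning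
    regroup₁ : ∀ M Q r → M * Q * (Q + r * Q) ≡ suc r * (M * (Q * Q))
    regroup₁ = solve-∀
    regroup₂ : ∀ r T → suc r * (r * T) ≡ r * (suc r * T)
    regroup₂ = solve-∀
    regroup₃ : ∀ r M Q → r * (M * (Q * (suc r + Q))) ≡ M * Q * (r * suc r + r * Q)
    regroup₃ = solve-∀
  Q<q² : Q < suc r * suc r
  Q<q² = ≤-<-trans (+-cancelʳ-≤ (r * Q) Q (r * suc r) (*-cancelˡ-≤ (M * Q) scaled))
                   (m<n+m (r * suc r) (s≤s z≤n))

module Vectors (p : ℕ) {{_ : NonZero p}} where

  vectors : ∀ k → List (𝔽^ p k)
  vectors k = functions k (allFin p)

  length-vectors : ∀ k → length (vectors k) ≡ p ^ k
  length-vectors k = trans (length-functions k (allFin p)) (cong (_^ k) (length-allFin p))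

  δᵛ : ∀ {k} → 𝔽^ p k → 𝔽^ p k → ℕ
  δᵛ {k} u v = ∏[ i < k ] δ (u i) (v i)

  δᵛ≤1 : ∀ {k} (u v : 𝔽^ p k) → δᵛ u v ≤ 1
  δᵛ≤1 {k} u v = ≤-trans (∏-mono-≤ k (λ i → δ≤1 (u i) (v i))) (≤-reflexive (∏-1 k))

  δᵛ-pos⇒≗ : ∀ {k} {u v : 𝔽^ p k} → 0 < δᵛ u v → u ≗ v
  δᵛ-pos⇒≗ {k} 0<δ i = δ-pos⇒≡ (∏-pos⇒pos k _ 0<δ i)

  δᵛ-zero⇒≢ : ∀ {k} {u v : 𝔽^ p k} → δᵛ u v ≡ 0 → Σ[ i ∈ Fin k ] u i ≢ v i
  δᵛ-zero⇒≢ {k} δ≡0 with ∏-zero⇒zero k _ δ≡0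
  ... | i , δi≡0 = i , δ-zero⇒≢ δi≡0

  δᵛ-congʳ : ∀ {k} (u : 𝔽^ p k) {v w : 𝔽^ p k} → v ≗ w → δᵛ u v ≡ δᵛ u w
  δᵛ-congʳ {k} u v≗w = ∏-cong k (λ i → cong (δ (u i)) (v≗w i))

  ∑-δᵛ : ∀ {k} (u : 𝔽^ p k) → ∑[ v ∈ vectors k ] δᵛ u v ≡ 1
  ∑-δᵛ {k} u = trans (∑-functions-∏ k (allFin p) (λ i → δ (u i)))
                     (trans (∏-cong k (λ i → ∑-δ (u i))) (∏-1 k))

  ∑-δᵛ*δᵛ : ∀ {k} (u v : 𝔽^ p k) → ∑[ w ∈ vectors k ] (δᵛ u w * δᵛ v w) ≡ δᵛ u v
  ∑-δᵛ*δᵛ {k} u v = begin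
    ∑[ w ∈ vectors k ] (δᵛ u w * δᵛ v w)                   ≡⟨ ∑-cong (vectors k) (λ w → ∏-distrib-* k _ _) ⟨
    ∑[ w ∈ vectors k ] ∏[ i < k ] (δ (u i) (w i) * δ (v i) (w i))
                                                          ≡⟨ ∑-functions-∏ k (allFin p) _ ⟩
    ∏[ i < k ] ∑[ c ∈ allFin p ] (δ (u i) c * δ (v i) c)  ≡⟨ ∏-cong k (λ i → ∑-δ*δ (u i) (v i)) ⟩
    δᵛ u v                                                ∎
    where open ≡-Reasoning

  ∃-≗-in-vectors : ∀ {k} (u : 𝔽^ p k) → Any (_≗ u) (vectors k)
  ∃-≗-in-vectors u = Any.map (λ 0<δ → sym ∘ δᵛ-pos⇒≗ 0<δ)
    (∑-pos⇒Any (vectors _) (δᵛ u) (subst (0 <_) (sym (∑-δᵛ u)) (s≤s z≤n)))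

  ∑-determined-coordinate : ∀ {n} (j : Fin n) (g : 𝔽^ p n → ℕ) → (∀ r → g r ≤ 1) →
    (∀ {r r′} → (∀ i → i ≢ j → r i ≡ r′ i) → g r ≡ 1 → g r′ ≡ 1 → r j ≡ r′ j) →
    p * ∑ (vectors n) g ≤ p ^ n
  ∑-determined-coordinate {suc n} zero g g≤1 determined = *-monoʳ-≤ p (begin
    ∑ (vectors (suc n)) g                            ≡⟨ ∑-functions-suc n (allFin p) g ⟩
    ∑[ a ∈ allFin p ] ∑[ r ∈ vectors n ] g (a ∷ᵛ r)   ≡⟨ ∑-comm (allFin p) (vectors n) _ ⟩
    ∑[ r ∈ vectors n ] ∑[ a ∈ allFin p ] g (a ∷ᵛ r)   ≤⟨ ∑-mono-≤ (vectors n) at-most-one ⟩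
    ∑[ r ∈ vectors n ] 1                             ≡⟨ ∑-1 (vectors n) ⟩
    length (vectors n)                               ≡⟨ length-vectors n ⟩
    p ^ n                                            ∎)
    where
    open ≤-Reasoning
    at-most-one : ∀ r → ∑[ a ∈ allFin p ] g (a ∷ᵛ r) ≤ 1
    at-most-one r = ∑-allFin-≤1 (λ a → g (a ∷ᵛ r)) (λ a → g≤1 (a ∷ᵛ r)) (determined tail-agree)
      where
      tail-agree : ∀ {a b} i → i ≢ zero → (a ∷ᵛ r) i ≡ (b ∷ᵛ r) i
      tail-agree zero    i≢0 = contradiction refl i≢0
      tail-agree (suc i) i≢0 = refl
  ∑-determined-coordinate {suc n} (suc j) g g≤1 determined = begin
    p * ∑ (vectors (suc n)) g                              ≡⟨ cong (p *_) (∑-functions-suc n (allFin p) g) ⟩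
    p * ∑[ a ∈ allFin p ] ∑[ r ∈ vectors n ] g (a ∷ᵛ r)     ≡⟨ *-distribˡ-∑ (allFin p) p _ ⟩
    ∑[ a ∈ allFin p ] (p * ∑[ r ∈ vectors n ] g (a ∷ᵛ r))   ≤⟨ ∑-mono-≤ (allFin p) fibre ⟩
    ∑[ a ∈ allFin p ] (p ^ n)                              ≡⟨ ∑-const (allFin p) (p ^ n) ⟩
    length (allFin p) * p ^ n                              ≡⟨ cong (_* p ^ n) (length-allFin p) ⟩
    p ^ suc n                                              ∎
    where
    open ≤-Reasoning
    fibre : ∀ a → p * ∑[ r ∈ vectors n ] g (a ∷ᵛ r) ≤ p ^ n
    fibre a = ∑-determined-coordinate j (λ r → g (a ∷ᵛ r)) (λ r → g≤1 (a ∷ᵛ r))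
      (λ agree → determined (head-agree agree))
      where
      head-agree : ∀ {r r′} → (∀ i → i ≢ j → r i ≡ r′ i) → ∀ i → i ≢ suc j → (a ∷ᵛ r) i ≡ (a ∷ᵛ r′) i
      head-agree agree zero    i≢j = refl
      head-agree agree (suc i) i≢j = agree i (i≢j ∘ cong suc)

module Linear (p : ℕ) {{_ : NonZero p}} where

  infix 4 _≡ₚ_
  _≡ₚ_ : ℕ → ℕ → Set
  a ≡ₚ b = a % p ≡ b % p

  toℕ-mod : ∀ a → toℕ (a mod p) ≡ₚ a
  toℕ-mod a = trans (cong (_% p) (Fin.toℕ-fromℕ< _)) (m%n%n≡m%n a p)

  +-cong-≡ₚ : ∀ {a a′ b b′} → a ≡ₚ a′ → b ≡ₚ b′ → a + b ≡ₚ a′ + b′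
  +-cong-≡ₚ {a} {a′} {b} {b′} a≡a′ b≡b′ =
    trans (%-distribˡ-+ a b p) (trans (cong₂ (λ x y → (x + y) % p) a≡a′ b≡b′) (sym (%-distribˡ-+ a′ b′ p)))

  *-cong-≡ₚ : ∀ {a a′ b b′} → a ≡ₚ a′ → b ≡ₚ b′ → a * b ≡ₚ a′ * b′
  *-cong-≡ₚ {a} {a′} {b} {b′} a≡a′ b≡b′ =
    trans (%-distribˡ-* a b p) (trans (cong₂ (λ x y → (x * y) % p) a≡a′ b≡b′) (sym (%-distribˡ-* a′ b′ p)))

  mod-cong : ∀ {a b} → a ≡ₚ b → a mod p ≡ b mod p
  mod-cong {a} {b} a≡b = Fin.toℕ-injective
    (trans (Fin.toℕ-fromℕ< _) (trans a≡b (sym (Fin.toℕ-fromℕ< _))))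

  %≡⇒+*≡ : ∀ a b → a ≡ₚ b → a + b / p * p ≡ b + a / p * p
  %≡⇒+*≡ a b a≡b = begin
    a + b / p * p                     ≡⟨ cong (_+ b / p * p) (m≡m%n+[m/n]*n a p) ⟩
    a % p + a / p * p + b / p * p     ≡⟨ cong (λ r → r + a / p * p + b / p * p) a≡b ⟩
    b % p + a / p * p + b / p * p     ≡⟨ swap (b % p) (a / p * p) (b / p * p) ⟩
    b % p + b / p * p + a / p * p     ≡⟨ cong (_+ a / p * p) (m≡m%n+[m/n]*n b p) ⟨
    b + a / p * p                     ∎
    where
    open ≡-Reasoning
    swap : ∀ x y z → x + y + z ≡ x + z + y
    swap = solve-∀

  -- R, R′ stand for r · x and r′ · x where r, r′ differ only in one coordinate (entries u, u′ there, and
  -- s the entry of x), likewise S, S′ for x′ (entry t). Subtracting the two congruences eliminates α, β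
  -- and leaves (u − u′)(s − t) ≡ 0 mod p, written here without subtraction.
  exchange-congruence : ∀ {u u′ s t} α β R R′ S S′ → α + R ≡ₚ β + S → α + R′ ≡ₚ β + S′ →
    R + u′ * s ≡ R′ + u * s → S + u′ * t ≡ S′ + u * t →
    Σ[ k ∈ ℕ ] Σ[ l ∈ ℕ ] u * s + u′ * t + k * p ≡ u * t + u′ * s + l * p
  exchange-congruence {u} {u′} {s} {t} α β R R′ S S′ c₁ c₂ e₁ e₂ =
    B₁ + A₂ , A₁ + B₂ , +-cancelˡ-≡ (α + β + R + R′ + S + S′) _ _ (begin
        α + β + R + R′ + S + S′ + (u * s + u′ * t + (B₁ + A₂) * p)
      ≡⟨ regroup₁ α β R R′ S S′ u u′ s t B₁ A₂ p ⟩
        (α + R + B₁ * p) + (β + S′ + A₂ * p) + (R′ + u * s) + (S + u′ * t)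
      ≡⟨ cong₂ _+_ (cong₂ _+_ (cong₂ _+_ (%≡⇒+*≡ _ _ c₁) (sym (%≡⇒+*≡ _ _ c₂))) (sym e₁)) e₂ ⟩
        (β + S + A₁ * p) + (α + R′ + B₂ * p) + (R + u′ * s) + (S′ + u * t)
      ≡⟨ regroup₂ α β R R′ S S′ u u′ s t A₁ B₂ p ⟩
        α + β + R + R′ + S + S′ + (u * t + u′ * s + (A₁ + B₂) * p)
      ∎)
    where
    open ≡-Reasoning
    A₁ = (α + R) / p
    B₁ = (β + S) / p
    A₂ = (α + R′) / p
    B₂ = (β + S′) / p
    regroup₁ : ∀ α β R R′ S S′ u u′ s t B₁ A₂ p →
      α + β + R + R′ + S + S′ + (u * s + u′ * t + (B₁ + A₂) * p)
        ≡ (α + R + B₁ * p) + (β + S′ + A₂ * p) + (R′ + u * s) + (S + u′ * t)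
    regroup₁ = solve-∀
    regroup₂ : ∀ α β R R′ S S′ u u′ s t A₁ B₂ p →
      (β + S + A₁ * p) + (α + R′ + B₂ * p) + (R + u′ * s) + (S′ + u * t)
        ≡ α + β + R + R′ + S + S′ + (u * t + u′ * s + (A₁ + B₂) * p)
    regroup₂ = solve-∀

  toℕ-+ₚ : ∀ (a b : 𝔽 p) → toℕ (a +ₚ b) ≡ₚ toℕ a + toℕ b
  toℕ-+ₚ a b = toℕ-mod (toℕ a + toℕ b)

  toℕ-*ₚ : ∀ (a b : 𝔽 p) → toℕ (a *ₚ b) ≡ₚ toℕ a * toℕ b
  toℕ-*ₚ a b = toℕ-mod (toℕ a * toℕ b)

  -- The dot product is computed in ℕ and only reduced mod p afterwards.
  infix 7 _·_
  _·_ : ∀ {k} → 𝔽^ p k → 𝔽^ p k → ℕ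
  _·_ {zero}  r x = 0
  _·_ {suc k} r x = toℕ (r zero) * toℕ (x zero) + (r ∘ suc) · (x ∘ suc)

  ·-congˡ : ∀ {k} {r r′ : 𝔽^ p k} (x : 𝔽^ p k) → r ≗ r′ → r · x ≡ r′ · x
  ·-congˡ {zero}  x r≗r′ = refl
  ·-congˡ {suc k} x r≗r′ = cong₂ (λ a b → toℕ a * toℕ (x zero) + b) (r≗r′ zero) (·-congˡ (x ∘ suc) (r≗r′ ∘ suc))

  ·-exchange : ∀ {k} (r r′ x : 𝔽^ p k) (j : Fin k) → (∀ i → i ≢ j → r i ≡ r′ i) →
    r · x + toℕ (r′ j) * toℕ (x j) ≡ r′ · x + toℕ (r j) * toℕ (x j)
  ·-exchange {suc k} r r′ x zero    agree =
    trans (cong (λ d → toℕ (r zero) * toℕ (x zero) + d + toℕ (r′ zero) * toℕ (x zero))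
                (·-congˡ (x ∘ suc) (λ i → agree (suc i) (λ ()))))
          (swap (toℕ (r zero) * toℕ (x zero)) (toℕ (r′ zero) * toℕ (x zero)) _)
    where
    swap : ∀ a b d → a + d + b ≡ b + d + a
    swap = solve-∀
  ·-exchange {suc k} r r′ x (suc j) agree =
    trans (+-assoc (toℕ (r zero) * toℕ (x zero)) _ _)
    (trans (cong₂ (λ a b → toℕ a * toℕ (x zero) + b) (agree zero (λ ()))
             (·-exchange (r ∘ suc) (r′ ∘ suc) (x ∘ suc) j (λ i i≢j → agree (suc i) (i≢j ∘ Fin.suc-injective))))
           (sym (+-assoc (toℕ (r′ zero) * toℕ (x zero)) _ _)))

  ·-distribˡ-⊕ : ∀ {k} (r x y : 𝔽^ p k) → r · (x ⊕ y) ≡ₚ r · x + r · y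
  ·-distribˡ-⊕ {zero}  r x y = refl
  ·-distribˡ-⊕ {suc k} r x y = trans
    (+-cong-≡ₚ (*-cong-≡ₚ {toℕ (r zero)} refl (toℕ-+ₚ (x zero) (y zero))) (·-distribˡ-⊕ (r ∘ suc) (x ∘ suc) (y ∘ suc)))
    (cong (_% p) (regroup (toℕ (r zero)) (toℕ (x zero)) (toℕ (y zero)) _ _))
    where
    regroup : ∀ a b c d e → a * (b + c) + (d + e) ≡ a * b + d + (a * c + e)
    regroup = solve-∀

  ·-⊙ : ∀ {k} (r : 𝔽^ p k) (c : 𝔽 p) (x : 𝔽^ p k) → r · (c ⊙ x) ≡ₚ toℕ c * (r · x)
  ·-⊙ {zero}  r c x = cong (_% p) (sym (*-zeroʳ (toℕ c)))
  ·-⊙ {suc k} r c x = trans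
    (+-cong-≡ₚ (*-cong-≡ₚ {toℕ (r zero)} refl (toℕ-*ₚ c (x zero))) (·-⊙ (r ∘ suc) c (x ∘ suc)))
    (cong (_% p) (regroup (toℕ (r zero)) (toℕ c) (toℕ (x zero)) _))
    where
    regroup : ∀ a c b d → a * (c * b) + c * d ≡ c * (a * b + d)
    regroup = solve-∀

  linear : ∀ {n m} → (Fin m → 𝔽^ p n) → 𝔽^ p n → 𝔽^ p m
  linear A x i = (A i · x) mod p

  linear-isLinear : ∀ {n m} (A : Fin m → 𝔽^ p n) → IsLinear (linear A)
  linear-isLinear A = record
    { additive    = λ x y i → mod-cong (trans (·-distribˡ-⊕ (A i) x y)
                                (sym (+-cong-≡ₚ (toℕ-mod (A i · x)) (toℕ-mod (A i · y)))))
    ; homogeneous = λ c x i → mod-cong (trans (·-⊙ (A i) c x)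
                                (sym (*-cong-≡ₚ {toℕ c} refl (toℕ-mod (A i · x)))))
    }

module PrimeField (p : ℕ) {{_ : NonZero p}} (p-prime : Prime p) where

  open Vectors p
  open Linear p

  cross⇒≡⊎≡-ordered : ∀ {a b c d k l} → a < p → c < p → b ≤ a → d ≤ c →
    a * c + b * d + k * p ≡ a * d + b * c + l * p → a ≡ b ⊎ c ≡ d
  cross⇒≡⊎≡-ordered {a} {b} {c} {d} {k} {l} a<p c<p b≤a d≤c eq
    with euclidsLemma (a ∸ b) (c ∸ d) p-prime p∣product
    where
    p∣product : p ∣ (a ∸ b) * (c ∸ d)
    p∣product = ∣m+n∣m⇒∣n (subst (p ∣_) (trans (sym (cross-difference b≤a d≤c eq)) (+-comm _ (k * p)))
                                  (n∣m*n l))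
                          (n∣m*n k)
  ... | inj₁ p∣a∸b = inj₁ (≤-antisym (m∸n≡0⇒m≤n (<∧∣⇒≡0 (≤-<-trans (m∸n≤m a b) a<p) p∣a∸b)) b≤a)
  ... | inj₂ p∣c∸d = inj₂ (≤-antisym (m∸n≡0⇒m≤n (<∧∣⇒≡0 (≤-<-trans (m∸n≤m c d) c<p) p∣c∸d)) d≤c)

  private
    swap-first : ∀ x y {z} x′ y′ {z′} → x + y + z ≡ x′ + y′ + z′ → y + x + z ≡ y′ + x′ + z′
    swap-first x y {z} x′ y′ {z′} eq =
      trans (cong (_+ z) (+-comm y x)) (trans eq (cong (_+ z′) (+-comm x′ y′)))

  cross⇒≡⊎≡ : ∀ {a b c d k l} → a < p → b < p → c < p → d < p →
    a * c + b * d + k * p ≡ a * d + b * c + l * p → a ≡ b ⊎ c ≡ d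
  cross⇒≡⊎≡ {a} {b} {c} {d} {k} {l} a<p b<p c<p d<p eq with ≤-total b a | ≤-total d c
  ... | inj₁ b≤a | inj₁ d≤c = cross⇒≡⊎≡-ordered {k = k} {l} a<p c<p b≤a d≤c eq
  ... | inj₂ a≤b | inj₂ c≤d = Sum.map sym sym
    (cross⇒≡⊎≡-ordered {k = k} {l} b<p d<p a≤b c≤d (swap-first (a * c) (b * d) (a * d) (b * c) eq))
  ... | inj₁ b≤a | inj₂ c≤d = Sum.map id sym (cross⇒≡⊎≡-ordered {k = l} {k} a<p d<p b≤a c≤d (sym eq))
  ... | inj₂ a≤b | inj₁ d≤c = Sum.map sym id
    (cross⇒≡⊎≡-ordered {k = l} {k} b<p c<p a≤b d≤c (swap-first (a * d) (b * c) (a * c) (b * d) (sym eq)))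

  coordinate-determined : ∀ (u u′ s t : Fin p) → s ≢ t → ∀ α β R R′ S S′ →
    α + R ≡ₚ β + S → α + R′ ≡ₚ β + S′ →
    R + toℕ u′ * toℕ s ≡ R′ + toℕ u * toℕ s → S + toℕ u′ * toℕ t ≡ S′ + toℕ u * toℕ t → u ≡ u′
  coordinate-determined u u′ s t s≢t α β R R′ S S′ c₁ c₂ e₁ e₂
    with k , l , cross ← exchange-congruence {toℕ u} {toℕ u′} {toℕ s} {toℕ t} α β R R′ S S′ c₁ c₂ e₁ e₂
    with cross⇒≡⊎≡ {k = k} {l} (Fin.toℕ<n u) (Fin.toℕ<n u′) (Fin.toℕ<n s) (Fin.toℕ<n t) cross
  ... | inj₁ u≡u′ = Fin.toℕ-injective u≡u′
  ... | inj₂ s≡t  = contradiction (Fin.toℕ-injective s≡t) s≢t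

  row-collisions : ∀ {n} (x x′ : 𝔽^ p n) (k : Fin n) → x k ≢ x′ k → (α β : 𝔽 p) →
    p * ∑[ r ∈ vectors n ] δ (α +ₚ ((r · x) mod p)) (β +ₚ ((r · x′) mod p)) ≤ p ^ n
  row-collisions x x′ k xk≢x′k α β =
    ∑-determined-coordinate k _ (λ r → δ≤1 (α +ₚ ((r · x) mod p)) (β +ₚ ((r · x′) mod p))) λ {r} {r′} agree e e′ →
      coordinate-determined (r k) (r′ k) (x k) (x′ k) xk≢x′k (toℕ α) (toℕ β) (r · x) (r′ · x) (r · x′) (r′ · x′)
        (congruence r e) (congruence r′ e′) (·-exchange r r′ x k agree) (·-exchange r r′ x′ k agree)
    where
    toℕ-affine : ∀ (γ : 𝔽 p) a → toℕ (γ +ₚ (a mod p)) ≡ₚ toℕ γ + a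
    toℕ-affine γ a = trans (toℕ-+ₚ γ (a mod p)) (+-cong-≡ₚ {toℕ γ} refl (toℕ-mod a))
    congruence : ∀ r → δ (α +ₚ ((r · x) mod p)) (β +ₚ ((r · x′) mod p)) ≡ 1 → toℕ α + r · x ≡ₚ toℕ β + r · x′
    congruence r e = trans (sym (toℕ-affine α (r · x)))
      (trans (cong (λ z → toℕ z % p) (δ-pos⇒≡ (subst (0 <_) (sym e) (s≤s z≤n)))) (toℕ-affine β (r · x′)))

module Collisions (p : ℕ) {{_ : NonZero p}} (p-prime : Prime p) {n m : ℕ} (F : 𝔽^ p n → 𝔽^ p m) where

  open Vectors p
  open Linear p
  open PrimeField p p-prime

  matrices : List (Fin m → 𝔽^ p n)
  matrices = functions m (vectors n)

  length-matrices : length matrices ≡ (p ^ n) ^ m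
  length-matrices = trans (length-functions m (vectors n)) (cong (_^ m) (length-vectors n))

  perturbed : (Fin m → 𝔽^ p n) → 𝔽^ p n → 𝔽^ p m
  perturbed A = F ⊞ linear A

  pair-collisions-distinct : ∀ (x x′ : 𝔽^ p n) (k : Fin n) → x k ≢ x′ k →
    p ^ m * ∑[ A ∈ matrices ] δᵛ (perturbed A x) (perturbed A x′) ≤ (p ^ n) ^ m
  pair-collisions-distinct x x′ k xk≢x′k = begin
    p ^ m * ∑[ A ∈ matrices ] ∏[ i < m ] row i (A i)
      ≡⟨ cong₂ _*_ (sym (∏-const m p)) (∑-functions-∏ m (vectors n) row) ⟩
    ∏[ i < m ] p * ∏[ i < m ] ∑ (vectors n) (row i)
      ≡⟨ ∏-distrib-* m (λ _ → p) (λ i → ∑ (vectors n) (row i)) ⟨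
    ∏[ i < m ] (p * ∑ (vectors n) (row i))
      ≤⟨ ∏-mono-≤ m (λ i → row-collisions x x′ k xk≢x′k (F x i) (F x′ i)) ⟩
    ∏[ i < m ] (p ^ n)
      ≡⟨ ∏-const m (p ^ n) ⟩
    (p ^ n) ^ m
      ∎
    where
    open ≤-Reasoning
    row : Fin m → 𝔽^ p n → ℕ
    row i r = δ (F x i +ₚ ((r · x) mod p)) (F x′ i +ₚ ((r · x′) mod p))

  private
    pad₀ : ∀ q M → M ≡ M * (q * 0 + 1)
    pad₀ = solve-∀
    pad₁ : ∀ q M → q * M + M ≡ M * (q * 1 + 1)
    pad₁ = solve-∀

  pair-collisions : ∀ (x x′ : 𝔽^ p n) →
    p ^ m * ∑[ A ∈ matrices ] δᵛ (perturbed A x) (perturbed A x′) ≤ (p ^ n) ^ m * (p ^ m * δᵛ x x′ + 1)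
  pair-collisions x x′ with n≤1⇒n≡0∨n≡1 (δᵛ≤1 x x′)
  ... | inj₁ δ≡0 rewrite δ≡0 with δᵛ-zero⇒≢ δ≡0
  ...   | k , xk≢x′k = ≤-trans (pair-collisions-distinct x x′ k xk≢x′k) (≤-reflexive (pad₀ (p ^ m) _))
  pair-collisions x x′ | inj₂ δ≡1 rewrite δ≡1 = begin
    p ^ m * ∑[ A ∈ matrices ] δᵛ (perturbed A x) (perturbed A x′)
                                        ≤⟨ *-monoʳ-≤ (p ^ m) (∑-mono-≤ matrices at-most-one) ⟩
    p ^ m * ∑[ A ∈ matrices ] 1          ≡⟨ cong (p ^ m *_) (trans (∑-1 matrices) length-matrices) ⟩
    p ^ m * (p ^ n) ^ m                  ≤⟨ m≤m+n _ _ ⟩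
    p ^ m * (p ^ n) ^ m + (p ^ n) ^ m    ≡⟨ pad₁ (p ^ m) ((p ^ n) ^ m) ⟩
    (p ^ n) ^ m * (p ^ m * 1 + 1)        ∎
    where
    open ≤-Reasoning
    at-most-one : ∀ A → δᵛ (perturbed A x) (perturbed A x′) ≤ 1
    at-most-one A = δᵛ≤1 (perturbed A x) (perturbed A x′)

  collisions : (Fin m → 𝔽^ p n) → ℕ
  collisions A = ∑[ x ∈ vectors n ] ∑[ x′ ∈ vectors n ] δᵛ (perturbed A x) (perturbed A x′)

  ∑-collisions-upper : p ^ m * ∑ matrices collisions ≤ (p ^ n) ^ m * (p ^ n * (p ^ m + p ^ n))
  ∑-collisions-upper = begin
    q * ∑[ A ∈ matrices ] ∑[ x ∈ V ] ∑[ x′ ∈ V ] coll A x x′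
      ≡⟨ cong (q *_) (∑-comm matrices V _) ⟩
    q * ∑[ x ∈ V ] ∑[ A ∈ matrices ] ∑[ x′ ∈ V ] coll A x x′
      ≡⟨ cong (q *_) (∑-cong V (λ x → ∑-comm matrices V _)) ⟩
    q * ∑[ x ∈ V ] ∑[ x′ ∈ V ] ∑[ A ∈ matrices ] coll A x x′
      ≡⟨ *-distribˡ-∑ V q _ ⟩
    ∑[ x ∈ V ] (q * ∑[ x′ ∈ V ] ∑[ A ∈ matrices ] coll A x x′)
      ≡⟨ ∑-cong V (λ x → *-distribˡ-∑ V q _) ⟩
    ∑[ x ∈ V ] ∑[ x′ ∈ V ] (q * ∑[ A ∈ matrices ] coll A x x′)
      ≤⟨ ∑-mono-≤ V (λ x → ∑-mono-≤ V (pair-collisions x)) ⟩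
    ∑[ x ∈ V ] ∑[ x′ ∈ V ] (M * (q * δᵛ x x′ + 1))
      ≡⟨ ∑-cong V (λ x → *-distribˡ-∑ V M _) ⟨
    ∑[ x ∈ V ] (M * ∑[ x′ ∈ V ] (q * δᵛ x x′ + 1))
      ≡⟨ *-distribˡ-∑ V M _ ⟨
    M * ∑[ x ∈ V ] ∑[ x′ ∈ V ] (q * δᵛ x x′ + 1)
      ≡⟨ cong (M *_) (∑-cong V row-sum) ⟩
    M * ∑[ x ∈ V ] (q + Q)
      ≡⟨ cong (M *_) (trans (∑-const V (q + Q)) (cong (_* (q + Q)) (length-vectors n))) ⟩
    M * (Q * (q + Q))
      ∎
    where
    open ≤-Reasoning
    q = p ^ m
    Q = p ^ n
    M = (p ^ n) ^ m
    V = vectors n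
    coll : (Fin m → 𝔽^ p n) → 𝔽^ p n → 𝔽^ p n → ℕ
    coll A x x′ = δᵛ (perturbed A x) (perturbed A x′)
    row-sum : ∀ x → ∑[ x′ ∈ V ] (q * δᵛ x x′ + 1) ≡ q + Q
    row-sum x = begin-equality
      ∑[ x′ ∈ V ] (q * δᵛ x x′ + 1)        ≡⟨ ∑-distrib-+ V _ _ ⟩
      ∑[ x′ ∈ V ] (q * δᵛ x x′) + ∑[ x′ ∈ V ] 1
                                          ≡⟨ cong₂ _+_ (sym (*-distribˡ-∑ V q (δᵛ x))) (∑-1 V) ⟩
      q * ∑[ x′ ∈ V ] δᵛ x x′ + length V  ≡⟨ cong₂ (λ s l → q * s + l) (∑-δᵛ x) (length-vectors n) ⟩
      q * 1 + Q                           ≡⟨ cong (_+ Q) (*-identityʳ q) ⟩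
      q + Q                               ∎

  fibre : (Fin m → 𝔽^ p n) → 𝔽^ p m → ℕ
  fibre A y = ∑[ x ∈ vectors n ] δᵛ (perturbed A x) y

  ∑-fibre : ∀ A → ∑[ y ∈ vectors m ] fibre A y ≡ p ^ n
  ∑-fibre A = begin
    ∑[ y ∈ vectors m ] ∑[ x ∈ vectors n ] δᵛ (perturbed A x) y   ≡⟨ ∑-comm (vectors m) (vectors n) _ ⟩
    ∑[ x ∈ vectors n ] ∑[ y ∈ vectors m ] δᵛ (perturbed A x) y   ≡⟨ ∑-cong (vectors n) (λ x → ∑-δᵛ (perturbed A x)) ⟩
    ∑[ x ∈ vectors n ] 1                                        ≡⟨ ∑-1 (vectors n) ⟩
    length (vectors n)                                          ≡⟨ length-vectors n ⟩
    p ^ n                                                       ∎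
    where open ≡-Reasoning

  collisions≡∑fibre² : ∀ A → collisions A ≡ ∑[ y ∈ vectors m ] (fibre A y * fibre A y)
  collisions≡∑fibre² A = begin
    ∑[ x ∈ V ] ∑[ x′ ∈ V ] δᵛ (G x) (G x′)
                                ≡⟨ ∑-cong V (λ x → ∑-cong V (λ x′ → ∑-δᵛ*δᵛ (G x) (G x′))) ⟨
    ∑[ x ∈ V ] ∑[ x′ ∈ V ] ∑[ y ∈ W ] (δᵛ (G x) y * δᵛ (G x′) y)  ≡⟨ ∑-cong V (λ x → ∑-comm V W _) ⟩
    ∑[ x ∈ V ] ∑[ y ∈ W ] ∑[ x′ ∈ V ] (δᵛ (G x) y * δᵛ (G x′) y)  ≡⟨ ∑-comm V W _ ⟩
    ∑[ y ∈ W ] ∑[ x ∈ V ] ∑[ x′ ∈ V ] (δᵛ (G x) y * δᵛ (G x′) y)  ≡⟨ ∑-cong W (λ y → ∑-*-∑ V V _ _) ⟨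
    ∑[ y ∈ W ] (fibre A y * fibre A y)                           ∎
    where
    open ≡-Reasoning
    V = vectors n
    W = vectors m
    G = perturbed A

  -- By Cauchy–Schwarz against the indicator of the q − 1 points y ≠ b, which carry the whole mass p ^ n.
  collisions-lower : ∀ A b → fibre A b ≡ 0 → p ^ n * p ^ n ≤ (p ^ m ∸ 1) * collisions A
  collisions-lower A b empty = subst₂ _≤_
    (cong₂ _*_ ∑off*fibre ∑off*fibre)
    (cong₂ _*_ (trans (∑-cong W (λ y → n≤1⇒n*n≡n (off≤1 y))) ∑off) (sym (collisions≡∑fibre² A)))
    (cauchy-schwarz W off (fibre A))
    where
    W = vectors m
    off : 𝔽^ p m → ℕ
    off y = 1 ∸ δᵛ b y
    off≤1 : ∀ y → off y ≤ 1
    off≤1 y = m∸n≤m 1 (δᵛ b y)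
    off*fibre : ∀ y → off y * fibre A y ≡ fibre A y
    off*fibre y with n≤1⇒n≡0∨n≡1 (δᵛ≤1 b y)
    ... | inj₁ δ≡0 rewrite δ≡0 = +-identityʳ (fibre A y)
    ... | inj₂ δ≡1 rewrite δ≡1 = sym (trans (∑-cong (vectors n) (λ x → δᵛ-congʳ (perturbed A x) (sym ∘ b≗y))) empty)
      where
      b≗y : b ≗ y
      b≗y = δᵛ-pos⇒≗ (subst (0 <_) (sym δ≡1) (s≤s z≤n))
    ∑off*fibre : ∑[ y ∈ W ] (off y * fibre A y) ≡ p ^ n
    ∑off*fibre = trans (∑-cong W off*fibre) (∑-fibre A)
    ∑off : ∑ W off ≡ p ^ m ∸ 1
    ∑off = begin
      ∑ W off                              ≡⟨ m+n∸n≡m (∑ W off) 1 ⟨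
      ∑ W off + 1 ∸ 1                      ≡⟨ cong (λ s → ∑ W off + s ∸ 1) (∑-δᵛ b) ⟨
      ∑ W off + ∑ W (δᵛ b) ∸ 1             ≡⟨ cong (_∸ 1) (∑-distrib-+ W off (δᵛ b)) ⟨
      ∑[ y ∈ W ] (off y + δᵛ b y) ∸ 1      ≡⟨ cong (_∸ 1) (∑-cong W (λ y → m∸n+n≡m (δᵛ≤1 b y))) ⟩
      ∑[ y ∈ W ] 1 ∸ 1                     ≡⟨ cong (_∸ 1) (trans (∑-1 W) (length-vectors m)) ⟩
      p ^ m ∸ 1                            ∎
      where open ≡-Reasoning

  inhabited-fibres⇒surjective : ∀ A → All (λ y → 0 < fibre A y) (vectors m) → Surjective _≡_ _≗_ (perturbed A)
  inhabited-fibres⇒surjective A inhabited b with All.lookupAny inhabited (∃-≗-in-vectors b)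
  ... | 0<fibre , y≗b with Any.satisfied (∑-pos⇒Any (vectors n) _ 0<fibre)
  ... | x , 0<δ = x , λ { refl i → trans (δᵛ-pos⇒≗ {u = perturbed A x} 0<δ i) (y≗b i) }

  ∑-collisions-lower : All (λ A → ¬ All (λ y → 0 < fibre A y) (vectors m)) matrices →
    (p ^ n) ^ m * (p ^ n * p ^ n) ≤ (p ^ m ∸ 1) * ∑ matrices collisions
  ∑-collisions-lower none-inhabited = begin
    (p ^ n) ^ m * (p ^ n * p ^ n)                   ≡⟨ cong (_* (p ^ n * p ^ n)) length-matrices ⟨
    length matrices * (p ^ n * p ^ n)               ≡⟨ ∑-const matrices (p ^ n * p ^ n) ⟨
    ∑[ A ∈ matrices ] (p ^ n * p ^ n)               ≤⟨ ∑-mono-≤-on (All.map empty-fibre none-inhabited) ⟩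
    ∑[ A ∈ matrices ] ((p ^ m ∸ 1) * collisions A)  ≡⟨ *-distribˡ-∑ matrices (p ^ m ∸ 1) collisions ⟨
    (p ^ m ∸ 1) * ∑ matrices collisions             ∎
    where
    open ≤-Reasoning
    empty-fibre : ∀ {A} → ¬ All (λ y → 0 < fibre A y) (vectors m) → p ^ n * p ^ n ≤ (p ^ m ∸ 1) * collisions A
    empty-fibre {A} not-all with Any.satisfied (¬All⇒Any¬ (λ y → 0 <? fibre A y) (vectors m) not-all)
    ... | b , ¬0<fibre = collisions-lower A b (n≤0⇒n≡0 (≮⇒≥ ¬0<fibre))

  inhabited-fibres-somewhere : p ^ m * p ^ m ≤ p ^ n →
    Σ[ A ∈ (Fin m → 𝔽^ p n) ] All (λ y → 0 < fibre A y) (vectors m)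
  inhabited-fibres-somewhere q²≤Q with any? (λ A → all? (λ y → 0 <? fibre A y) (vectors m)) matrices
  ... | yes some = Any.satisfied some
  ... | no  none = ⊥-elim (collision-bounds-incompatible (p ^ m) (p ^ n) ((p ^ n) ^ m) (∑ matrices collisions)
                     (m^n>0 p m) (m^n>0 p n) (m^n>0 (p ^ n) {{m^n≢0 p n}} m) q²≤Q
                     ∑-collisions-upper (∑-collisions-lower (¬Any⇒All¬ matrices none)))

theorem4p6 : (p : ℕ) {{_ : NonZero p}} → Prime p → (n m : ℕ) → 2 * m ≤ n →
    (F : 𝔽^ p n → 𝔽^ p m) →
    Σ[ L ∈ (𝔽^ p n → 𝔽^ p m) ] (IsLinear L × Surjective _≡_ _≗_ (F ⊞ L))
theorem4p6 p p-prime n m 2m≤n F =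
  let A , inhabited = inhabited-fibres-somewhere q²≤Q
  in linear A , linear-isLinear A , inhabited-fibres⇒surjective A inhabited
  where
  open Linear p
  open Collisions p p-prime F
  q²≤Q : p ^ m * p ^ m ≤ p ^ n
  q²≤Q = subst (_≤ p ^ n) (trans (cong (λ k → p ^ (m + k)) (+-identityʳ m)) (^-distribˡ-+-* p m m))
               (^-monoʳ-≤ p 2m≤n)
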